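{- Let $k \geq 1$ and let $C_n^k$ be the $k$-th power of a cycle on $n$ vertices. Then: if $n \leq 2k+1$, every biclique of $C_n^k$ induces $P_2$; if $2k+2 \leq n \leq 3k+1$, every biclique of $C_n^k$ induces $C_4$; if $3k+2 \leq n \leq 4k$, every biclique of $C_n^k$ induces either $P_3$ or $C_4$, and bicliques of both kinds exist; if $n \geq 4k+1$, every biclique of $C_n^k$ induces $P_3$.
   Context: For $k \geq 1$, the power of a cycle $C_n^k$ is the simple graph with vertex set $\{v_0,\dots,v_{n-1}\}$ in which $v_i v_j$ ($i\neq j$) is an edge if and only if $\min\{(j-i) \bmod n, (i-j) \bmod n\} \leq k$. A biclique of a graph is a maximal (under inclusion) set of vertices inducing a complete bipartite subgraph with at least one edge. $P_2$, $P_3$ denote paths on 2 and 3 vertices and $C_4$ the cycle on 4 vertices. -}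

module Defs where

open import Data.Nat using (ℕ; zero; suc; _+_; _∸_; _≤_; _⊓_)
open import Data.Nat.DivMod using (_%_)
open import Data.Fin using (Fin; toℕ)
open import Data.Fin.Subset using (Subset; _∈_; _∉_; _⊆_; Nonempty)
open import Data.Product using (_×_; ∃-syntax)
open import Data.Sum using (_⊎_)
open import Relation.Nullary using (¬_)
open import Relation.Binary.PropositionalEquality using (_≡_; _≢_)

Graph : ℕ → Set₁
Graph n = Fin n → Fin n → Set

CyclePow : (n k : ℕ) → Graph n
CyclePow (suc m) k i j =
  (i ≢ j) × (((toℕ j + suc m ∸ toℕ i) % suc m) ⊓ ((toℕ i + suc m ∸ toℕ j) % suc m) ≤ k)

module _ {n : ℕ} (G : Graph n) where

  IsCompleteBipartite : Subset n → Set
  IsCompleteBipartite S = ∃[ X ] ∃[ Y ]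
    ((∀ v → v ∈ S → v ∈ X ⊎ v ∈ Y) × X ⊆ S × Y ⊆ S ×
     (∀ v → v ∈ X → v ∉ Y) ×
     Nonempty X × Nonempty Y ×
     (∀ x y → x ∈ X → y ∈ Y → G x y) ×
     (∀ x x′ → x ∈ X → x′ ∈ X → ¬ G x x′) ×
     (∀ y y′ → y ∈ Y → y′ ∈ Y → ¬ G y y′))

  IsBiclique : Subset n → Set
  IsBiclique S = IsCompleteBipartite S × (∀ T → S ⊆ T → IsCompleteBipartite T → T ⊆ S)

  InducesP₂ : Subset n → Set
  InducesP₂ S = ∃[ a ] ∃[ b ]
    ((∀ v → v ∈ S → v ≡ a ⊎ v ≡ b) × a ∈ S × b ∈ S × a ≢ b × G a b)

  InducesP₃ : Subset n → Set
  InducesP₃ S = ∃[ a ] ∃[ b ] ∃[ c ]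
    ((∀ v → v ∈ S → v ≡ a ⊎ v ≡ b ⊎ v ≡ c) × a ∈ S × b ∈ S × c ∈ S ×
     a ≢ b × b ≢ c × a ≢ c × G a b × G b c × ¬ G a c)

  InducesC₄ : Subset n → Set
  InducesC₄ S = ∃[ a ] ∃[ b ] ∃[ c ] ∃[ d ]
    ((∀ v → v ∈ S → v ≡ a ⊎ v ≡ b ⊎ v ≡ c ⊎ v ≡ d) ×
     a ∈ S × b ∈ S × c ∈ S × d ∈ S ×
     a ≢ b × a ≢ c × a ≢ d × b ≢ c × b ≢ d × c ≢ d ×
     G a b × G b c × G c d × G d a × ¬ G a c × ¬ G b d)

-- Rotate the cycle so that a vertex c sits at position 0.  Its neighbours are then the
-- positions 1 … k ahead of it and n - k … n - 1 behind it, and for n ≥ 2k + 2 each of these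
-- two arcs is a clique; so no neighbourhood contains three independent vertices and each side
-- of a biclique has one or two vertices.  A complete bipartite set is a biclique exactly when
-- each side contains every vertex adjacent to all of the other side and to none of its own.
-- A single edge is never a biclique: each end has a neighbour far from the other end.  If y
-- is adjacent to independent x (ahead) and x′ (behind), these have a common neighbour far
-- from y whenever n ≤ 3k + 1, which excludes P₃ bicliques there; and a vertex y′ far
-- from y adjacent to both forces x′ ≤ x + 2k, i.e. n ≤ 4k, which excludes C₄ bicliques for
-- n ≥ 4k + 1.  For 3k + 2 ≤ n ≤ 4k the sets {0, k, n - 1} and {0, k, 2k, n - k} are bicliques
-- inducing P₃ and C₄, and for n ≤ 2k + 1 the graph is complete.

module Submission where

open import Defs
open import Data.Nat
  using (ℕ; NonZero; zero; suc; _+_; _∸_; _*_; _⊓_; _≤_; _≰_; _<_; s≤s; s≤s⁻¹; z≤n; z<s; _≤?_)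
open import Data.Nat.Properties
open import Data.Nat.DivMod using (_%_; %-distribˡ-+; m%n%n≡m%n; [m+n]%n≡m%n; m<n⇒m%n≡m; m%n<n; n%n≡0)
open import Data.Nat.Tactic.RingSolver using (solve-∀)
open import Data.Fin using (Fin; zero; toℕ; fromℕ<)
open import Data.Fin.Properties using (any?; toℕ<n; toℕ-injective; toℕ-fromℕ<) renaming (_≟_ to _≟ᶠ_)
open import Data.Fin.Subset using (Subset; _∈_; _∉_; _⊆_; Nonempty; _∪_; ⁅_⁆)
open import Data.Fin.Subset.Properties using (x∈⁅x⁆; x∈⁅y⁆⇒x≡y; x∈p∪q⁻; p⊆p∪q; q⊆p∪q; _∈?_)
open import Data.Product using (_×_; _,_; ∃-syntax; proj₁; proj₂; uncurry; swap)
open import Data.Sum using (_⊎_; inj₁; inj₂; [_,_]′)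
import Data.Sum as Sum
import Data.Product as Product
open import Data.Empty using (⊥; ⊥-elim)
open import Function using (_∘_; _∘′_)
open import Relation.Nullary using (¬_; yes; no)
open import Relation.Nullary.Decidable using (_×-dec_; ¬?)
open import Relation.Binary using (tri<; tri≈; tri>)
open import Relation.Binary.Definitions using (Symmetric)
open import Relation.Binary.PropositionalEquality

m∸n≤o⇒m≤n+o : ∀ {m n o} → m ∸ n ≤ o → m ≤ n + o
m∸n≤o⇒m≤n+o {m} {n} le = ≤-trans (m≤n+m∸n m n) (+-monoʳ-≤ n le)

m⊓n≤o⇒m≤o⊎n≤o : ∀ {m n o} → m ⊓ n ≤ o → m ≤ o ⊎ n ≤ o
m⊓n≤o⇒m≤o⊎n≤o {m} {n} le with ⊓-sel m n
... | inj₁ eq = inj₁ (subst (_≤ _) eq le)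
... | inj₂ eq = inj₂ (subst (_≤ _) eq le)

[m%d+n]%d≡[m+n]%d : ∀ m n d .{{_ : NonZero d}} → (m % d + n) % d ≡ (m + n) % d
[m%d+n]%d≡[m+n]%d m n d = begin
  (m % d + n) % d           ≡⟨ %-distribˡ-+ (m % d) n d ⟩
  (m % d % d + n % d) % d   ≡⟨ cong (λ x → (x + n % d) % d) (m%n%n≡m%n m d) ⟩
  (m % d + n % d) % d       ≡⟨ %-distribˡ-+ m n d ⟨
  (m + n) % d               ∎
  where open ≡-Reasoning

[m+n%d]%d≡[m+n]%d : ∀ m n d .{{_ : NonZero d}} → (m + n % d) % d ≡ (m + n) % d
[m+n%d]%d≡[m+n]%d m n d = begin
  (m + n % d) % d   ≡⟨ cong (_% d) (+-comm m (n % d)) ⟩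
  (n % d + m) % d   ≡⟨ [m%d+n]%d≡[m+n]%d n m d ⟩
  (n + m) % d       ≡⟨ cong (_% d) (+-comm n m) ⟩
  (m + n) % d       ∎
  where open ≡-Reasoning

2*k+1≡1+[k+k] : ∀ k → 2 * k + 1 ≡ suc (k + k)
2*k+1≡1+[k+k] = solve-∀
2*k+2≡2+[k+k] : ∀ k → 2 * k + 2 ≡ suc (suc (k + k))
2*k+2≡2+[k+k] = solve-∀
3*k+1≡1+[k+k+k] : ∀ k → 3 * k + 1 ≡ suc (k + k + k)
3*k+1≡1+[k+k+k] = solve-∀
3*k+2≡2+[k+k+k] : ∀ k → 3 * k + 2 ≡ suc (suc (k + k + k))
3*k+2≡2+[k+k+k] = solve-∀
4*k≡k+k+k+k : ∀ k → 4 * k ≡ k + k + k + k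
4*k≡k+k+k+k = solve-∀
4*k+1≡1+[k+k+k+k] : ∀ k → 4 * k + 1 ≡ suc (k + k + k + k)
4*k+1≡1+[k+k+k+k] = solve-∀

∈-∪-elim : ∀ {a n} {A : Set a} {x : Fin n} (p q : Subset n) →
           (x ∈ p → A) → (x ∈ q → A) → x ∈ p ∪ q → A
∈-∪-elim p q f g x∈p∪q = [ f , g ]′ (x∈p∪q⁻ p q x∈p∪q)

pair : ∀ {n} → Fin n → Fin n → Subset n
pair a b = ⁅ a ⁆ ∪ ⁅ b ⁆

∈-⁅⁆-elim : ∀ {p n} (P : Fin n → Set p) {a v} → P a → v ∈ ⁅ a ⁆ → P v
∈-⁅⁆-elim P {a} Pa v∈a = subst P (sym (x∈⁅y⁆⇒x≡y a v∈a)) Pa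

≡⊎≡-elim : ∀ {a p} {A : Set a} (P : A → Set p) {x y v} → P x → P y → v ≡ x ⊎ v ≡ y → P v
≡⊎≡-elim P Px Py (inj₁ refl) = Px
≡⊎≡-elim P Px Py (inj₂ refl) = Py

∈-pair⁻ : ∀ {n} {a b v : Fin n} → v ∈ pair a b → v ≡ a ⊎ v ≡ b
∈-pair⁻ {a = a} {b} = ∈-∪-elim ⁅ a ⁆ ⁅ b ⁆ (inj₁ ∘′ x∈⁅y⁆⇒x≡y a) (inj₂ ∘′ x∈⁅y⁆⇒x≡y b)

∈-pair-elim : ∀ {p n} (P : Fin n → Set p) {a b v} → P a → P b → v ∈ pair a b → P v
∈-pair-elim P Pa Pb = ≡⊎≡-elim P Pa Pb ∘′ ∈-pair⁻

a∈pair : ∀ {n} (a b : Fin n) → a ∈ pair a b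
a∈pair a b = p⊆p∪q ⁅ b ⁆ (x∈⁅x⁆ a)

b∈pair : ∀ {n} (a b : Fin n) → b ∈ pair a b
b∈pair a b = q⊆p∪q ⁅ a ⁆ ⁅ b ⁆ (x∈⁅x⁆ b)

∈-pair⁺ : ∀ {n} {a b v : Fin n} → v ≡ a ⊎ v ≡ b → v ∈ pair a b
∈-pair⁺ {a = a} {b} = ≡⊎≡-elim (_∈ pair a b) (a∈pair a b) (b∈pair a b)

⊆⁅a⁆⊎∃≢a : ∀ {n} (X : Subset n) (a : Fin n) →
           (∀ v → v ∈ X → v ≡ a) ⊎ ∃[ b ] (b ∈ X × a ≢ b)
⊆⁅a⁆⊎∃≢a X a with any? (λ v → (v ∈? X) ×-dec ¬? (a ≟ᶠ v))
... | yes (b , b∈X , a≢b) = inj₂ (b , b∈X , a≢b)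
... | no ∄other = inj₁ only-a
  where
  only-a : ∀ v → v ∈ X → v ≡ a
  only-a v v∈X with a ≟ᶠ v
  ... | yes a≡v = sym a≡v
  ... | no a≢v = ⊥-elim (∄other (v , v∈X , a≢v))

module Bicliques {n : ℕ} (G : Graph n) (G-sym : Symmetric G) (G-irrefl : ∀ {v} → ¬ G v v) where

  Independent : Subset n → Set
  Independent X = ∀ x x′ → x ∈ X → x′ ∈ X → ¬ G x x′

  Complete : Subset n → Subset n → Set
  Complete X Y = ∀ x y → x ∈ X → y ∈ Y → G x y

  record Bipartition (S X Y : Subset n) : Set where
    field
      cover         : ∀ v → v ∈ S → v ∈ X ⊎ v ∈ Y
      X⊆S           : X ⊆ S
      Y⊆S           : Y ⊆ S
      disjoint      : ∀ v → v ∈ X → v ∉ Y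
      X-nonempty    : Nonempty X
      Y-nonempty    : Nonempty Y
      complete      : Complete X Y
      X-independent : Independent X
      Y-independent : Independent Y

  bipartition : ∀ {S} → IsCompleteBipartite G S → ∃[ X ] ∃[ Y ] Bipartition S X Y
  bipartition (X , Y , cover , X⊆S , Y⊆S , disjoint , X≠∅ , Y≠∅ , complete , X-ind , Y-ind) =
    X , Y , record
      { cover = cover ; X⊆S = X⊆S ; Y⊆S = Y⊆S ; disjoint = disjoint
      ; X-nonempty = X≠∅ ; Y-nonempty = Y≠∅
      ; complete = complete ; X-independent = X-ind ; Y-independent = Y-ind }

  isCompleteBipartite : ∀ {S X Y} → Bipartition S X Y → IsCompleteBipartite G S
  isCompleteBipartite {X = X} {Y} B = X , Y , cover , X⊆S , Y⊆S , disjoint ,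
    X-nonempty , Y-nonempty , complete , X-independent , Y-independent
    where open Bipartition B

  swapParts : ∀ {S X Y} → Bipartition S X Y → Bipartition S Y X
  swapParts B = record
    { cover = λ v v∈S → [ inj₂ , inj₁ ]′ (cover v v∈S)
    ; X⊆S = Y⊆S ; Y⊆S = X⊆S
    ; disjoint = λ v v∈Y v∈X → disjoint v v∈X v∈Y
    ; X-nonempty = Y-nonempty ; Y-nonempty = X-nonempty
    ; complete = λ y x y∈Y x∈X → G-sym (complete x y x∈X y∈Y)
    ; X-independent = Y-independent ; Y-independent = X-independent }
    where open Bipartition B

  complete⇒disjoint : ∀ {X Y} → Complete X Y → ∀ v → v ∈ X → v ∉ Y
  complete⇒disjoint complete v v∈X v∈Y = G-irrefl (complete v v v∈X v∈Y)

  unionBipartition : ∀ {X Y} → Nonempty X → Nonempty Y →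
                     Complete X Y → Independent X → Independent Y → Bipartition (X ∪ Y) X Y
  unionBipartition {X} {Y} X≠∅ Y≠∅ complete X-ind Y-ind = record
    { cover = λ v → x∈p∪q⁻ X Y ; X⊆S = p⊆p∪q Y ; Y⊆S = q⊆p∪q X Y
    ; disjoint = complete⇒disjoint complete ; X-nonempty = X≠∅ ; Y-nonempty = Y≠∅
    ; complete = complete ; X-independent = X-ind ; Y-independent = Y-ind }

  pair-independent : ∀ {a b} → ¬ G a b → Independent (pair a b)
  pair-independent {a} {b} ¬ab u u′ u∈ u′∈ = ∈-pair-elim (λ u → ¬ G u u′)
    (∈-pair-elim (λ u′ → ¬ G a u′) G-irrefl ¬ab u′∈)
    (∈-pair-elim (λ u′ → ¬ G b u′) (¬ab ∘′ G-sym) G-irrefl u′∈) u∈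

  singleton-independent : ∀ {a} → Independent ⁅ a ⁆
  singleton-independent {a} u u′ u∈ u′∈ = ∈-⁅⁆-elim (λ u → ¬ G u u′) (∈-⁅⁆-elim (¬_ ∘′ G a) G-irrefl u′∈) u∈

  pair-complete : ∀ {a b c d} → G a c → G a d → G b c → G b d → Complete (pair a b) (pair c d)
  pair-complete {a} {b} ac ad bc bd u w u∈ w∈ = ∈-pair-elim (λ u → G u w)
    (∈-pair-elim (G a) ac ad w∈) (∈-pair-elim (G b) bc bd w∈) u∈

  pair-singleton-complete : ∀ {a b c} → G a c → G b c → Complete (pair a b) ⁅ c ⁆
  pair-singleton-complete {a} {b} ac bc u w u∈ w∈ = ∈-pair-elim (λ u → G u w)
    (∈-⁅⁆-elim (G a) ac w∈) (∈-⁅⁆-elim (G b) bc w∈) u∈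

  Saturated : Subset n → Subset n → Set
  Saturated X Y = ∀ z → (∀ y → y ∈ Y → G z y) → (∀ x → x ∈ X → ¬ G z x) → z ∈ X

  ∪⁅⁆-complete : ∀ {X Y z} → Complete X Y → (∀ y → y ∈ Y → G z y) → Complete (X ∪ ⁅ z ⁆) Y
  ∪⁅⁆-complete {X} {Y} {z} complete z-Y x y =
    ∈-∪-elim X ⁅ z ⁆ (complete x y) (∈-⁅⁆-elim (λ x → y ∈ Y → G x y) (z-Y y))

  ∪⁅⁆-independent : ∀ {X z} → Independent X → (∀ x → x ∈ X → ¬ G z x) → Independent (X ∪ ⁅ z ⁆)
  ∪⁅⁆-independent {X} {z} X-ind z-X x x′ = ∈-∪-elim X ⁅ z ⁆
    (λ x∈X → ∈-∪-elim X ⁅ z ⁆ (X-ind x x′ x∈X) (∈-⁅⁆-elim (¬_ ∘′ G x) (z-X x x∈X ∘′ G-sym)))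
    (∈-⁅⁆-elim (λ x → x′ ∈ X ∪ ⁅ z ⁆ → ¬ G x x′)
      (∈-∪-elim X ⁅ z ⁆ (z-X x′) (∈-⁅⁆-elim (¬_ ∘′ G z) G-irrefl)))

  biclique⇒saturated : ∀ {S X Y} → IsBiclique G S → Bipartition S X Y → Saturated X Y
  biclique⇒saturated {S} {X} {Y} (_ , maximal) B z z-Y z-X
    with cover z (maximal (X′ ∪ Y) S⊆T (isCompleteBipartite B′) z∈T)
    where
    open Bipartition B
    X′ = X ∪ ⁅ z ⁆
    B′ : Bipartition (X′ ∪ Y) X′ Y
    B′ = unionBipartition (Product.map₂ (p⊆p∪q ⁅ z ⁆) X-nonempty) Y-nonempty
      (∪⁅⁆-complete complete z-Y) (∪⁅⁆-independent X-independent z-X) Y-independent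
    S⊆T : S ⊆ X′ ∪ Y
    S⊆T {v} v∈S = [ p⊆p∪q Y ∘′ p⊆p∪q ⁅ z ⁆ , q⊆p∪q X′ Y ]′ (cover v v∈S)
    z∈T : z ∈ X′ ∪ Y
    z∈T = p⊆p∪q Y (q⊆p∪q X ⁅ z ⁆ (x∈⁅x⁆ z))
  ... | inj₁ z∈X = z∈X
  ... | inj₂ z∈Y = ⊥-elim (G-irrefl (z-Y z z∈Y))

  parts-aligned : ∀ {S X Y T A B} → Bipartition S X Y → Bipartition T A B → S ⊆ T →
                  ∀ {x₀} → x₀ ∈ X → x₀ ∈ A → X ⊆ A × Y ⊆ B
  parts-aligned {X = X} {Y} {A = A} {B} BS BT S⊆T {x₀} x₀∈X x₀∈A = X⊆A , Y⊆B
    where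
    module S = Bipartition BS
    module T = Bipartition BT
    Y⊆B : Y ⊆ B
    Y⊆B {y} y∈Y with T.cover y (S⊆T (S.Y⊆S y∈Y))
    ... | inj₁ y∈A = ⊥-elim (T.X-independent x₀ y x₀∈A y∈A (S.complete x₀ y x₀∈X y∈Y))
    ... | inj₂ y∈B = y∈B
    X⊆A : X ⊆ A
    X⊆A {x} x∈X with T.cover x (S⊆T (S.X⊆S x∈X)) | S.Y-nonempty
    ... | inj₁ x∈A | _ = x∈A
    ... | inj₂ x∈B | y , y∈Y = ⊥-elim (T.Y-independent x y x∈B (Y⊆B y∈Y) (S.complete x y x∈X y∈Y))

  saturated-absorbs : ∀ {S X Y T A B} → Bipartition S X Y → Saturated X Y → Saturated Y X →
                      Bipartition T A B → X ⊆ A → Y ⊆ B → T ⊆ S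
  saturated-absorbs BS X-sat Y-sat BT X⊆A Y⊆B {v} v∈T =
    [ (λ v∈A → S.X⊆S (X-sat v (λ y y∈Y → T.complete v y v∈A (Y⊆B y∈Y))
                              (λ x x∈X → T.X-independent v x v∈A (X⊆A x∈X))))
    , (λ v∈B → S.Y⊆S (Y-sat v (λ x x∈X → G-sym (T.complete x v (X⊆A x∈X) v∈B))
                              (λ y y∈Y → T.Y-independent v y v∈B (Y⊆B y∈Y))))
    ]′ (T.cover v v∈T)
    where
    module S = Bipartition BS
    module T = Bipartition BT

  saturated⇒biclique : ∀ {S X Y} → Bipartition S X Y → Saturated X Y → Saturated Y X → IsBiclique G S
  saturated⇒biclique {S} B X-sat Y-sat = isCompleteBipartite B , maximal
    where
    open Bipartition B
    maximal : ∀ T → S ⊆ T → IsCompleteBipartite G T → T ⊆ S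
    maximal T S⊆T T-cb with bipartition T-cb | X-nonempty
    ... | A , B′ , BT | x₀ , x₀∈X with Bipartition.cover BT x₀ (S⊆T (X⊆S x₀∈X))
    ... | inj₁ x₀∈A = uncurry (saturated-absorbs B X-sat Y-sat BT) (parts-aligned B BT S⊆T x₀∈X x₀∈A)
    ... | inj₂ x₀∈B′ = uncurry (saturated-absorbs B X-sat Y-sat (swapParts BT))
                                (parts-aligned B (swapParts BT) S⊆T x₀∈X x₀∈B′)

  G⇒≢ : ∀ {u v} → G u v → u ≢ v
  G⇒≢ g refl = G-irrefl g

  induces-P₂ : ∀ {S X Y x y} → Bipartition S X Y → x ∈ X → y ∈ Y →
               (∀ v → v ∈ X → v ≡ x) → (∀ v → v ∈ Y → v ≡ y) → InducesP₂ G S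
  induces-P₂ {x = x} {y} B x∈X y∈Y X≡x Y≡y =
    x , y , (λ v v∈S → Sum.map (X≡x v) (Y≡y v) (cover v v∈S)) ,
    X⊆S x∈X , Y⊆S y∈Y , G⇒≢ xy , xy
    where
    open Bipartition B
    xy = complete x y x∈X y∈Y

  induces-P₃ : ∀ {S X Y x x′ y} → Bipartition S X Y → x ∈ X → x′ ∈ X → y ∈ Y → x ≢ x′ →
               (∀ v → v ∈ X → v ≡ x ⊎ v ≡ x′) → (∀ v → v ∈ Y → v ≡ y) → InducesP₃ G S
  induces-P₃ {x = x} {x′} {y} B x∈X x′∈X y∈Y x≢x′ X≡ Y≡y =
    x , y , x′ , (λ v v∈S → [ Sum.map₂ inj₂ ∘′ X≡ v , inj₂ ∘′ inj₁ ∘′ Y≡y v ]′ (cover v v∈S)) ,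
    X⊆S x∈X , Y⊆S y∈Y , X⊆S x′∈X ,
    G⇒≢ xy , G⇒≢ yx′ , x≢x′ , xy , yx′ , X-independent x x′ x∈X x′∈X
    where
    open Bipartition B
    xy = complete x y x∈X y∈Y
    yx′ = G-sym (complete x′ y x′∈X y∈Y)

  induces-C₄ : ∀ {S X Y x x′ y y′} → Bipartition S X Y → x ∈ X → x′ ∈ X → y ∈ Y → y′ ∈ Y →
               x ≢ x′ → y ≢ y′ → (∀ v → v ∈ X → v ≡ x ⊎ v ≡ x′) → (∀ v → v ∈ Y → v ≡ y ⊎ v ≡ y′) →
               InducesC₄ G S
  induces-C₄ {x = x} {x′} {y} {y′} B x∈X x′∈X y∈Y y′∈Y x≢x′ y≢y′ X≡ Y≡ =
    x , y , x′ , y′ ,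
    (λ v v∈S → [ [ inj₁ , inj₂ ∘′ inj₂ ∘′ inj₁ ]′ ∘′ X≡ v
               , [ inj₂ ∘′ inj₁ , inj₂ ∘′ inj₂ ∘′ inj₂ ]′ ∘′ Y≡ v ]′ (cover v v∈S)) ,
    X⊆S x∈X , Y⊆S y∈Y , X⊆S x′∈X , Y⊆S y′∈Y ,
    G⇒≢ xy , x≢x′ , G⇒≢ xy′ , G⇒≢ (G-sym x′y) , y≢y′ , G⇒≢ x′y′ ,
    xy , G-sym x′y , x′y′ , G-sym xy′ , X-independent x x′ x∈X x′∈X , Y-independent y y′ y∈Y y′∈Y
    where
    open Bipartition B
    xy = complete x y x∈X y∈Y
    xy′ = complete x y′ x∈X y′∈Y
    x′y = complete x′ y x′∈X y∈Y
    x′y′ = complete x′ y′ x′∈X y′∈Y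

module CyclePower (m k : ℕ) where

  n : ℕ
  n = suc m

  δ : ℕ → ℕ → ℕ
  δ u w = (w + n ∸ u) % n

  δ<n : ∀ u w → δ u w < n
  δ<n u w = m%n<n (w + n ∸ u) n

  δ-+ : ∀ {u} → u ≤ n → ∀ d → δ u ((u + d) % n) ≡ d % n
  δ-+ {u} u≤n d = begin
    ((u + d) % n + n ∸ u) % n     ≡⟨ cong (_% n) (+-∸-assoc ((u + d) % n) u≤n) ⟩
    ((u + d) % n + (n ∸ u)) % n   ≡⟨ [m%d+n]%d≡[m+n]%d (u + d) (n ∸ u) n ⟩
    (u + d + (n ∸ u)) % n         ≡⟨ cong (_% n) u+d+[n∸u]≡d+n ⟩
    (d + n) % n                   ≡⟨ [m+n]%n≡m%n d n ⟩
    d % n                         ∎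
    where
    open ≡-Reasoning
    u+d+[n∸u]≡d+n : u + d + (n ∸ u) ≡ d + n
    u+d+[n∸u]≡d+n = begin
      u + d + (n ∸ u)     ≡⟨ cong (_+ (n ∸ u)) (+-comm u d) ⟩
      d + u + (n ∸ u)     ≡⟨ +-assoc d u (n ∸ u) ⟩
      d + (u + (n ∸ u))   ≡⟨ cong (d +_) (m+[n∸m]≡n u≤n) ⟩
      d + n               ∎

  +-δ : ∀ {u w} → u ≤ n → w < n → (u + δ u w) % n ≡ w
  +-δ {u} {w} u≤n w<n = begin
    (u + (w + n ∸ u) % n) % n   ≡⟨ [m+n%d]%d≡[m+n]%d u (w + n ∸ u) n ⟩
    (u + (w + n ∸ u)) % n       ≡⟨ cong (_% n) (m+[n∸m]≡n (≤-trans u≤n (m≤n+m n w))) ⟩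
    (w + n) % n                 ≡⟨ [m+n]%n≡m%n w n ⟩
    w % n                       ≡⟨ m<n⇒m%n≡m w<n ⟩
    w                           ∎
    where open ≡-Reasoning

  -- Distances are invariant under rotating the cycle so that c becomes position 0.
  δ-rotate : ∀ {c u w} → c ≤ n → u < n → w < n → δ (δ c u) (δ c w) ≡ δ u w
  δ-rotate {c} {u} {w} c≤n u<n w<n = begin
    δ a (δ c w)                 ≡⟨ cong (δ a) δcw≡a+d ⟩
    δ a ((a + d) % n)           ≡⟨ δ-+ (<⇒≤ (δ<n c u)) d ⟩
    d % n                       ≡⟨ m<n⇒m%n≡m (δ<n u w) ⟩
    d                           ∎
    where
    open ≡-Reasoning
    a = δ c u
    d = δ u w
    δcw≡a+d : δ c w ≡ (a + d) % n
    δcw≡a+d = begin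
      δ c w                       ≡⟨ cong (δ c) (+-δ (<⇒≤ u<n) w<n) ⟨
      δ c ((u + d) % n)           ≡⟨ cong (λ x → δ c ((x + d) % n)) (+-δ c≤n u<n) ⟨
      δ c (((c + a) % n + d) % n) ≡⟨ cong (δ c) ([m%d+n]%d≡[m+n]%d (c + a) d n) ⟩
      δ c ((c + a + d) % n)       ≡⟨ cong (λ x → δ c (x % n)) (+-assoc c a d) ⟩
      δ c ((c + (a + d)) % n)     ≡⟨ δ-+ c≤n (a + d) ⟩
      (a + d) % n                 ∎

  δ-self : ∀ u → δ u u ≡ 0
  δ-self u = trans (cong (_% n) (m+n∸m≡n u n)) (n%n≡0 n)

  δ-forward : ∀ {u w} → u ≤ w → w < n → δ u w ≡ w ∸ u
  δ-forward {u} {w} u≤w w<n = begin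
    (w + n ∸ u) % n   ≡⟨ cong (_% n) (+-∸-comm n u≤w) ⟩
    (w ∸ u + n) % n   ≡⟨ [m+n]%n≡m%n (w ∸ u) n ⟩
    (w ∸ u) % n       ≡⟨ m<n⇒m%n≡m (≤-<-trans (m∸n≤m w u) w<n) ⟩
    w ∸ u             ∎
    where open ≡-Reasoning

  δ-backward : ∀ {u w} → u < w → δ w u ≡ u + n ∸ w
  δ-backward {u} {w} u<w = m<n⇒m%n≡m (m<n+o⇒m∸n<o (u + n) w (+-monoˡ-< n u<w))

  -- CyclePow n k on positions: G u v unfolds to Adj (toℕ u) (toℕ v), except that u ≢ v is on Fin n.
  Adj : ℕ → ℕ → Set
  Adj u w = u ≢ w × δ u w ⊓ δ w u ≤ k

  Adj-sym : ∀ {u w} → Adj u w → Adj w u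
  Adj-sym {u} {w} (u≢w , le) = u≢w ∘ sym , subst (_≤ k) (⊓-comm (δ u w) (δ w u)) le

  adj-within : ∀ {u w} → u < w → w < n → w ≤ u + k → Adj u w
  adj-within {u} {w} u<w w<n w≤u+k = <⇒≢ u<w ,
    m≤n⇒m⊓o≤n (δ w u) (subst (_≤ k) (sym (δ-forward (<⇒≤ u<w) w<n)) (m≤n+o⇒m∸n≤o w u w≤u+k))

  adj-around : ∀ {u w} → u < w → u + n ≤ w + k → Adj u w
  adj-around {u} {w} u<w u+n≤w+k = <⇒≢ u<w ,
    m≤n⇒o⊓m≤n (δ u w) (subst (_≤ k) (sym (δ-backward u<w)) (m≤n+o⇒m∸n≤o (u + n) w u+n≤w+k))

  adj-elim : ∀ {u w} → u < w → w < n → Adj u w → w ≤ u + k ⊎ u + n ≤ w + k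
  adj-elim {u} {w} u<w w<n (_ , le) with m⊓n≤o⇒m≤o⊎n≤o le
  ... | inj₁ δuw≤k = inj₁ (m∸n≤o⇒m≤n+o (subst (_≤ k) (δ-forward (<⇒≤ u<w) w<n) δuw≤k))
  ... | inj₂ δwu≤k = inj₂ (m∸n≤o⇒m≤n+o (subst (_≤ k) (δ-backward u<w) δwu≤k))

  -- The neighbours of position 0 are ahead of it or behind it; far positions are the others.
  Ahead Behind Far : ℕ → Set
  Ahead o = 0 < o × o ≤ k
  Behind o = o < n × n ≤ o + k
  Far o = k < o × o + k < n

  SameSide : ℕ → ℕ → Set
  SameSide u w = (Ahead u × Ahead w) ⊎ (Behind u × Behind w)

  sameSide-sym : ∀ {u w} → SameSide u w → SameSide w u
  sameSide-sym = Sum.map swap swap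

  far<n : ∀ {o} → Far o → o < n
  far<n {o} (_ , o+k<n) = ≤-<-trans (m≤m+n o k) o+k<n

  adj-0⇒ahead⊎behind : ∀ {o} → o < n → Adj 0 o → Ahead o ⊎ Behind o
  adj-0⇒ahead⊎behind {zero} _ (0≢0 , _) = ⊥-elim (0≢0 refl)
  adj-0⇒ahead⊎behind {suc o} o<n a = Sum.map (z<s ,_) (o<n ,_) (adj-elim z<s o<n a)

  far⇒¬adj-0 : ∀ {o} → Far o → ¬ Adj 0 o
  far⇒¬adj-0 far@(k<o , o+k<n) a with adj-elim (≤-<-trans z≤n k<o) (far<n far) a
  ... | inj₁ o≤k = <⇒≱ k<o o≤k
  ... | inj₂ n≤o+k = <⇒≱ o+k<n n≤o+k

  ¬adj-0⇒far : ∀ {o} → o < n → 0 ≢ o → ¬ Adj 0 o → Far o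
  ¬adj-0⇒far o<n 0≢o ¬a = ≰⇒> (¬a ∘ adj-within 0<o o<n) , ≰⇒> (¬a ∘ adj-around 0<o)
    where 0<o = n≢0⇒n>0 (0≢o ∘ sym)

  module _ (big : suc (suc (k + k)) ≤ n) where

    k<n : k < n
    k<n = ≤-trans (s≤s (m≤m+n k k)) (≤-trans (n≤1+n _) big)

    k<behind : ∀ {α} → Behind α → suc k < α
    k<behind {α} (_ , n≤α+k) = +-cancelʳ-≤ k (suc (suc k)) α (≤-trans big n≤α+k)

    ahead<behind : ∀ {β α} → Ahead β → Behind α → β < α
    ahead<behind (_ , β≤k) α-behind = ≤-<-trans β≤k (<-trans (n<1+n k) (k<behind α-behind))

    sameSide-adj< : ∀ {u w} → SameSide u w → u < w → Adj u w
    sameSide-adj< (inj₁ (_ , (_ , w≤k))) u<w =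
      adj-within u<w (≤-<-trans w≤k k<n) (≤-trans w≤k (m≤n+m k _))
    sameSide-adj< (inj₂ ((_ , n≤u+k) , (w<n , _))) u<w =
      adj-within u<w w<n (≤-trans (<⇒≤ w<n) n≤u+k)

    sameSide-adj : ∀ {u w} → SameSide u w → u ≢ w → Adj u w
    sameSide-adj {u} {w} s u≢w with <-cmp u w
    ... | tri< u<w _ _ = sameSide-adj< s u<w
    ... | tri≈ _ u≡w _ = ⊥-elim (u≢w u≡w)
    ... | tri> _ _ w<u = Adj-sym (sameSide-adj< (sameSide-sym s) w<u)

    ¬adj-ahead-behind⇒far-apart : ∀ {β α} → Ahead β → Behind α → ¬ Adj β α → α + k < β + n
    ¬adj-ahead-behind⇒far-apart β-ahead α-behind ¬a = ≰⇒> (¬a ∘ adj-around (ahead<behind β-ahead α-behind))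

    common-far-neighbour-bound : ∀ {β α γ} → Ahead β → Behind α → Far γ →
                                 Adj β γ → Adj γ α → α ≤ β + k + k
    common-far-neighbour-bound {β} {α} {γ} (_ , β≤k) (α<n , n≤α+k) γ-far@(k<γ , γ+k<n) βγ γα =
      ≤-trans α≤γ+k (+-monoˡ-≤ k γ≤β+k)
      where
      γ≤β+k : γ ≤ β + k
      γ≤β+k with adj-elim (≤-<-trans β≤k k<γ) (far<n γ-far) βγ
      ... | inj₁ γ≤β+k = γ≤β+k
      ... | inj₂ β+n≤γ+k = ⊥-elim (<⇒≱ γ+k<n (≤-trans (m≤n+m n β) β+n≤γ+k))
      α≤γ+k : α ≤ γ + k
      α≤γ+k with adj-elim (+-cancelʳ-< k γ α (<-≤-trans γ+k<n n≤α+k)) α<n γα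
      ... | inj₁ α≤γ+k = α≤γ+k
      ... | inj₂ γ+n≤α+k = ⊥-elim (<⇒≱ (+-mono-< k<γ α<n) (subst (γ + n ≤_) (+-comm α k) γ+n≤α+k))

    far-suc-k : Far (suc k)
    far-suc-k = n<1+n k , big

    ahead-adj-suc-k : ∀ {β} → Ahead β → Adj β (suc k)
    ahead-adj-suc-k (0<β , β≤k) = adj-within (s≤s β≤k) (far<n far-suc-k) (+-monoˡ-≤ k 0<β)

    far-neighbour : ∀ {o} → o < n → Adj 0 o → ∃[ γ ] Far γ × Adj o γ
    far-neighbour {o} o<n a with adj-0⇒ahead⊎behind o<n a
    ... | inj₁ o-ahead = suc k , far-suc-k , ahead-adj-suc-k o-ahead
    ... | inj₂ (_ , n≤o+k) = m ∸ k , (k<γ , γ+k<n) , Adj-sym (adj-within γ<o o<n o≤γ+k)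
      where
      γ+k≡m : m ∸ k + k ≡ m
      γ+k≡m = m∸n+n≡m (≤-trans (m≤m+n k k) (≤-trans (n≤1+n _) (s≤s⁻¹ big)))
      k<γ : k < m ∸ k
      k<γ = m+n≤o⇒m≤o∸n (suc k) (s≤s⁻¹ big)
      γ+k<n : m ∸ k + k < n
      γ+k<n = s≤s (≤-reflexive γ+k≡m)
      γ<o : m ∸ k < o
      γ<o = +-cancelʳ-< k (m ∸ k) o (<-≤-trans γ+k<n n≤o+k)
      o≤γ+k : o ≤ m ∸ k + k
      o≤γ+k = subst (o ≤_) (sym γ+k≡m) (s≤s⁻¹ o<n)

    far-common-neighbour : n ≤ suc (k + k + k) → ∀ {β α} → Ahead β → Behind α → α + k < β + n →
                           ∃[ γ ] Far γ × Adj β γ × Adj γ α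
    far-common-neighbour small {β} {α} β-ahead@(0<β , β≤k) α-behind@(α<n , _) α+k<β+n
      with α ≤? suc (k + k)
    ... | yes α≤2k+1 = suc k , far-suc-k , ahead-adj-suc-k β-ahead ,
                       adj-within (k<behind α-behind) α<n α≤2k+1
    ... | no α≰2k+1 = α ∸ k , (k<γ , γ+k<n) , adj-within β<γ (far<n (k<γ , γ+k<n)) γ≤β+k ,
                      adj-within γ<α α<n (≤-reflexive (sym γ+k≡α))
      where
      open ≤-Reasoning
      2k+1<α : suc (k + k) < α
      2k+1<α = ≰⇒> α≰2k+1
      γ+k≡α : α ∸ k + k ≡ α
      γ+k≡α = m∸n+n≡m (≤-trans (m≤m+n k k) (≤-trans (n≤1+n _) (<⇒≤ 2k+1<α)))
      k<γ : k < α ∸ k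
      k<γ = m+n≤o⇒m≤o∸n (suc k) (<⇒≤ 2k+1<α)
      γ+k<n : α ∸ k + k < n
      γ+k<n = subst (_< n) (sym γ+k≡α) α<n
      β<γ : β < α ∸ k
      β<γ = ≤-<-trans β≤k k<γ
      γ<α : α ∸ k < α
      γ<α = subst (α ∸ k <_) γ+k≡α (m<m+n (α ∸ k) (<-≤-trans 0<β β≤k))
      γ≤β+k : α ∸ k ≤ β + k
      γ≤β+k = +-cancelʳ-≤ k _ _ (+-cancelʳ-≤ k _ _ (s≤s⁻¹ (begin
        suc (α ∸ k + k + k)     ≡⟨ cong (λ x → suc (x + k)) γ+k≡α ⟩
        suc (α + k)             ≤⟨ α+k<β+n ⟩
        β + n                   ≤⟨ +-monoʳ-≤ β small ⟩
        β + suc (k + k + k)     ≡⟨ +-suc β (k + k + k) ⟩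
        suc (β + (k + k + k))   ≡⟨ cong suc (+-assoc β (k + k) k) ⟨
        suc (β + (k + k) + k)   ≡⟨ cong (λ x → suc (x + k)) (+-assoc β k k) ⟨
        suc (β + k + k + k)     ∎)))

  small-adj : n ≤ suc (k + k) → ∀ {u w} → u < w → w < n → Adj u w
  small-adj small {u} {w} u<w w<n with w ≤? u + k
  ... | yes w≤u+k = adj-within u<w w<n w≤u+k
  ... | no w≰u+k = adj-around u<w (begin
    u + n               ≤⟨ +-monoʳ-≤ u small ⟩
    u + suc (k + k)     ≡⟨ +-suc u (k + k) ⟩
    suc (u + (k + k))   ≡⟨ cong suc (+-assoc u k k) ⟨
    suc (u + k) + k     ≤⟨ +-monoˡ-≤ k (≰⇒> w≰u+k) ⟩
    w + k               ∎)
    where open ≤-Reasoning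

  sides-pigeonhole : ∀ {x y z} → Ahead x ⊎ Behind x → Ahead y ⊎ Behind y → Ahead z ⊎ Behind z →
                     SameSide x y ⊎ SameSide y z ⊎ SameSide x z
  sides-pigeonhole (inj₁ x) (inj₁ y) _        = inj₁ (inj₁ (x , y))
  sides-pigeonhole (inj₂ x) (inj₂ y) _        = inj₁ (inj₂ (x , y))
  sides-pigeonhole (inj₁ x) (inj₂ y) (inj₁ z) = inj₂ (inj₂ (inj₁ (x , z)))
  sides-pigeonhole (inj₁ x) (inj₂ y) (inj₂ z) = inj₂ (inj₁ (inj₂ (y , z)))
  sides-pigeonhole (inj₂ x) (inj₁ y) (inj₁ z) = inj₂ (inj₁ (inj₁ (y , z)))
  sides-pigeonhole (inj₂ x) (inj₁ y) (inj₂ z) = inj₂ (inj₂ (inj₂ (x , z)))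

  G : Graph n
  G = CyclePow n k

  pos : Fin n → Fin n → ℕ
  pos c v = δ (toℕ c) (toℕ v)

  pos<n : ∀ c v → pos c v < n
  pos<n c v = δ<n (toℕ c) (toℕ v)

  pos-self : ∀ c → pos c c ≡ 0
  pos-self c = δ-self (toℕ c)

  pos-injective : ∀ c {u v} → pos c u ≡ pos c v → u ≡ v
  pos-injective c {u} {v} eq = toℕ-injective (begin
    toℕ u                     ≡⟨ +-δ (<⇒≤ (toℕ<n c)) (toℕ<n u) ⟨
    (toℕ c + pos c u) % n     ≡⟨ cong (λ x → (toℕ c + x) % n) eq ⟩
    (toℕ c + pos c v) % n     ≡⟨ +-δ (<⇒≤ (toℕ<n c)) (toℕ<n v) ⟩
    toℕ v                     ∎)
    where open ≡-Reasoning

  vertexAt : Fin n → ℕ → Fin n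
  vertexAt c o = fromℕ< (m%n<n (toℕ c + o) n)

  pos-vertexAt : ∀ c {o} → o < n → pos c (vertexAt c o) ≡ o
  pos-vertexAt c {o} o<n = begin
    δ (toℕ c) (toℕ (vertexAt c o))   ≡⟨ cong (δ (toℕ c)) (toℕ-fromℕ< (m%n<n (toℕ c + o) n)) ⟩
    δ (toℕ c) ((toℕ c + o) % n)      ≡⟨ δ-+ (<⇒≤ (toℕ<n c)) o ⟩
    o % n                            ≡⟨ m<n⇒m%n≡m o<n ⟩
    o                                ∎
    where open ≡-Reasoning

  G-sym : Symmetric G
  G-sym (u≢v , le) = u≢v ∘ sym , subst (_≤ k) (⊓-comm _ _) le

  G-irrefl : ∀ {v} → ¬ G v v
  G-irrefl (v≢v , _) = v≢v refl

  δ-pos : ∀ c u v → δ (pos c u) (pos c v) ≡ δ (toℕ u) (toℕ v)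
  δ-pos c u v = δ-rotate (<⇒≤ (toℕ<n c)) (toℕ<n u) (toℕ<n v)

  G⇒Adj : ∀ c {u v} → G u v → Adj (pos c u) (pos c v)
  G⇒Adj c {u} {v} (u≢v , le) =
    u≢v ∘ pos-injective c , subst₂ (λ x y → x ⊓ y ≤ k) (sym (δ-pos c u v)) (sym (δ-pos c v u)) le

  Adj⇒G : ∀ c {u v} → Adj (pos c u) (pos c v) → G u v
  Adj⇒G c {u} {v} (pu≢pv , le) =
    pu≢pv ∘ cong (pos c) , subst₂ (λ x y → x ⊓ y ≤ k) (δ-pos c u v) (δ-pos c v u) le

  G⇒Adj-0 : ∀ c {v} → G c v → Adj 0 (pos c v)
  G⇒Adj-0 c {v} g = subst (λ x → Adj x (pos c v)) (pos-self c) (G⇒Adj c g)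

  Adj-0⇒G : ∀ c {v} → Adj 0 (pos c v) → G c v
  Adj-0⇒G c {v} a = Adj⇒G c (subst (λ x → Adj x (pos c v)) (sym (pos-self c)) a)

  pos≢0 : ∀ c {v} → c ≢ v → 0 ≢ pos c v
  pos≢0 c c≢v 0≡pos = c≢v (pos-injective c (trans (pos-self c) 0≡pos))

  adj-vertexAt : ∀ c {u γ} → γ < n → Adj (pos c u) γ → G u (vertexAt c γ)
  adj-vertexAt c {u} γ<n a = Adj⇒G c (subst (Adj (pos c u)) (sym (pos-vertexAt c γ<n)) a)

  far-vertexAt : ∀ c {γ} → Far γ → ¬ G c (vertexAt c γ) × c ≢ vertexAt c γ
  far-vertexAt c {γ} γ-far@(k<γ , _) =
    far⇒¬adj-0 (subst Far (sym pos≡γ) γ-far) ∘ G⇒Adj-0 c ,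
    λ c≡v → <⇒≢ (≤-<-trans z≤n k<γ) (trans (sym (pos-self c)) (trans (cong (pos c) c≡v) pos≡γ))
    where
    pos≡γ = pos-vertexAt c (far<n γ-far)

  ¬G⇒far : ∀ c {v} → c ≢ v → ¬ G c v → Far (pos c v)
  ¬G⇒far c c≢v ¬g = ¬adj-0⇒far (pos<n c _) (pos≢0 c c≢v) (¬g ∘ Adj-0⇒G c)

  Opposite : Fin n → Fin n → Fin n → Set
  Opposite c a b = Ahead (pos c a) × Behind (pos c b)

  module _ (big : suc (suc (k + k)) ≤ n) where

    neighbour-side : ∀ c {v} → G c v → Ahead (pos c v) ⊎ Behind (pos c v)
    neighbour-side c g = adj-0⇒ahead⊎behind (pos<n c _) (G⇒Adj-0 c g)

    sameSide-¬G⇒≡ : ∀ c {u w} → SameSide (pos c u) (pos c w) → ¬ G u w → u ≡ w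
    sameSide-¬G⇒≡ c {u} {w} s ¬g with pos c u ≟ pos c w
    ... | yes eq = pos-injective c eq
    ... | no neq = ⊥-elim (¬g (Adj⇒G c (sameSide-adj big s neq)))

    neighbourhood-independence≤2 : ∀ {c a b v} → G c a → G c b → ¬ G a b → a ≢ b →
                                   G c v → ¬ G a v → ¬ G b v → v ≡ a ⊎ v ≡ b
    neighbourhood-independence≤2 {c} ca cb ¬ab a≢b cv ¬av ¬bv
      with sides-pigeonhole (neighbour-side c ca) (neighbour-side c cb) (neighbour-side c cv)
    ... | inj₁ ab-side = ⊥-elim (a≢b (sameSide-¬G⇒≡ c ab-side ¬ab))
    ... | inj₂ (inj₁ bv-side) = inj₂ (sym (sameSide-¬G⇒≡ c bv-side ¬bv))
    ... | inj₂ (inj₂ av-side) = inj₁ (sym (sameSide-¬G⇒≡ c av-side ¬av))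

    nonadjacent-neighbours-opposite : ∀ {c a b} → G c a → G c b → ¬ G a b → a ≢ b →
                                      Opposite c a b ⊎ Opposite c b a
    nonadjacent-neighbours-opposite {c} ca cb ¬ab a≢b with neighbour-side c ca | neighbour-side c cb
    ... | inj₁ a-ahead  | inj₂ b-behind = inj₁ (a-ahead , b-behind)
    ... | inj₂ a-behind | inj₁ b-ahead  = inj₂ (b-ahead , a-behind)
    ... | inj₁ a-ahead  | inj₁ b-ahead  = ⊥-elim (a≢b (sameSide-¬G⇒≡ c (inj₁ (a-ahead , b-ahead)) ¬ab))
    ... | inj₂ a-behind | inj₂ b-behind = ⊥-elim (a≢b (sameSide-¬G⇒≡ c (inj₂ (a-behind , b-behind)) ¬ab))

    private-neighbour : ∀ {x y} → G x y → ∃[ z ] G y z × ¬ G x z × x ≢ z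
    private-neighbour {x} xy with far-neighbour big (pos<n x _) (G⇒Adj-0 x xy)
    ... | γ , γ-far , a = vertexAt x γ , adj-vertexAt x (far<n γ-far) a , far-vertexAt x γ-far

    common-neighbour-bound : ∀ {y a b v} → Opposite y a b → G a v → G b v → ¬ G y v → y ≢ v →
                             pos y b ≤ pos y a + k + k
    common-neighbour-bound {y} (a-ahead , b-behind) av bv ¬yv y≢v =
      common-far-neighbour-bound big a-ahead b-behind (¬G⇒far y y≢v ¬yv) (G⇒Adj y av) (Adj-sym (G⇒Adj y bv))

    opposite-common-neighbour⇒n≤4k : ∀ {y a b y′} → Opposite y a b → G a y′ → G b y′ →
                                     ¬ G y y′ → y ≢ y′ → n ≤ k + k + k + k
    opposite-common-neighbour⇒n≤4k {y} {a} {b} opp@((_ , a≤k) , (_ , n≤b+k)) ay′ by′ ¬yy′ y≢y′ = begin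
      n                       ≤⟨ n≤b+k ⟩
      pos y b + k             ≤⟨ +-monoˡ-≤ k (common-neighbour-bound opp ay′ by′ ¬yy′ y≢y′) ⟩
      pos y a + k + k + k     ≤⟨ +-monoˡ-≤ k (+-monoˡ-≤ k (+-monoˡ-≤ k a≤k)) ⟩
      k + k + k + k           ∎
      where open ≤-Reasoning

    no-induced-C₄ : k + k + k + k < n → ∀ {y y′ a b} → G y a → G y b → G y′ a → G y′ b →
                    ¬ G a b → a ≢ b → ¬ G y y′ → y ≢ y′ → ⊥
    no-induced-C₄ 4k<n ya yb y′a y′b ¬ab a≢b ¬yy′ y≢y′
      with nonadjacent-neighbours-opposite ya yb ¬ab a≢b
    ... | inj₁ opp = <⇒≱ 4k<n (opposite-common-neighbour⇒n≤4k opp (G-sym y′a) (G-sym y′b) ¬yy′ y≢y′)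
    ... | inj₂ opp = <⇒≱ 4k<n (opposite-common-neighbour⇒n≤4k opp (G-sym y′b) (G-sym y′a) ¬yy′ y≢y′)

    opposite-common-neighbour : n ≤ suc (k + k + k) → ∀ {y a b} → Opposite y a b → ¬ G a b →
                                ∃[ z ] G a z × G b z × ¬ G y z × y ≢ z
    opposite-common-neighbour small {y} {a} {b} (a-ahead , b-behind) ¬ab
      with far-common-neighbour big small a-ahead b-behind
             (¬adj-ahead-behind⇒far-apart big a-ahead b-behind (¬ab ∘ Adj⇒G y))
    ... | γ , γ-far , aγ , γb = vertexAt y γ , adj-vertexAt y γ<n aγ , adj-vertexAt y γ<n (Adj-sym γb) ,
                               far-vertexAt y γ-far
      where γ<n = far<n γ-far

    common-neighbour-outside : n ≤ suc (k + k + k) → ∀ {y a b} → G y a → G y b → ¬ G a b → a ≢ b →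
                               ∃[ z ] G a z × G b z × ¬ G y z × y ≢ z
    common-neighbour-outside small ya yb ¬ab a≢b with nonadjacent-neighbours-opposite ya yb ¬ab a≢b
    ... | inj₁ opp = opposite-common-neighbour small opp ¬ab
    ... | inj₂ opp = let z , bz , az , rest = opposite-common-neighbour small opp (¬ab ∘ G-sym)
                     in z , az , bz , rest

  open Bicliques G G-sym G-irrefl

  module _ (big : suc (suc (k + k)) ≤ n) where

    part-≤2 : ∀ {S X Y x₀} → Bipartition S X Y → x₀ ∈ X →
              (∀ v → v ∈ X → v ≡ x₀) ⊎ ∃[ x₁ ] (x₁ ∈ X × x₀ ≢ x₁ × (∀ v → v ∈ X → v ≡ x₀ ⊎ v ≡ x₁))
    part-≤2 {X = X} {x₀ = x₀} B x₀∈X with ⊆⁅a⁆⊎∃≢a X x₀ | Bipartition.Y-nonempty B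
    ... | inj₁ X≡x₀ | _ = inj₁ X≡x₀
    ... | inj₂ (x₁ , x₁∈X , x₀≢x₁) | y , y∈Y = inj₂ (x₁ , x₁∈X , x₀≢x₁ , λ v v∈X →
          neighbourhood-independence≤2 big (y- x₀∈X) (y- x₁∈X) (X-independent x₀ x₁ x₀∈X x₁∈X) x₀≢x₁
            (y- v∈X) (X-independent x₀ v x₀∈X v∈X) (X-independent x₁ v x₁∈X v∈X))
      where
      open Bipartition B
      y- : ∀ {x} → x ∈ X → G y x
      y- {x} x∈X = G-sym (complete x y x∈X y∈Y)

    single-single⇒⊥ : ∀ {S X Y x y} → IsBiclique G S → Bipartition S X Y → x ∈ X → y ∈ Y →
                      (∀ v → v ∈ X → v ≡ x) → (∀ v → v ∈ Y → v ≡ y) → ⊥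
    single-single⇒⊥ {x = x} {y} biclique B x∈X y∈Y X≡x Y≡y =
      let z , yz , ¬xz , x≢z = private-neighbour big (complete x y x∈X y∈Y)
      in x≢z (sym (X≡x z (biclique⇒saturated biclique B z
           (λ v v∈Y → subst (G z) (sym (Y≡y v v∈Y)) (G-sym yz))
           (λ v v∈X → subst (¬_ ∘ G z) (sym (X≡x v v∈X)) (¬xz ∘ G-sym)))))
      where open Bipartition B

    pair-single⇒P₃ : ∀ {S X Y x x′ y} → IsBiclique G S → Bipartition S X Y →
                     x ∈ X → x′ ∈ X → y ∈ Y → x ≢ x′ →
                     (∀ v → v ∈ X → v ≡ x ⊎ v ≡ x′) → (∀ v → v ∈ Y → v ≡ y) →
                     InducesP₃ G S × suc (suc (k + k + k)) ≤ n
    pair-single⇒P₃ {X = X} {x = x} {x′} {y} biclique B x∈X x′∈X y∈Y x≢x′ X≡ Y≡y =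
      induces-P₃ B x∈X x′∈X y∈Y x≢x′ X≡ Y≡y , ≰⇒> no-common-neighbour-outside
      where
      open Bipartition B
      yx : ∀ {v} → v ∈ X → G y v
      yx {v} v∈X = G-sym (complete v y v∈X y∈Y)
      no-common-neighbour-outside : ¬ n ≤ suc (k + k + k)
      no-common-neighbour-outside small =
        let z , xz , x′z , ¬yz , y≢z = common-neighbour-outside big small (yx x∈X) (yx x′∈X)
                                         (X-independent x x′ x∈X x′∈X) x≢x′
        in y≢z (sym (Y≡y z (biclique⇒saturated biclique (swapParts B) z
             (λ v v∈X → ≡⊎≡-elim (G z) (G-sym xz) (G-sym x′z) (X≡ v v∈X))
             (λ v v∈Y → subst (¬_ ∘ G z) (sym (Y≡y v v∈Y)) (¬yz ∘ G-sym)))))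

    pair-pair⇒C₄ : ∀ {S X Y x x′ y y′} → Bipartition S X Y →
                   x ∈ X → x′ ∈ X → y ∈ Y → y′ ∈ Y → x ≢ x′ → y ≢ y′ →
                   (∀ v → v ∈ X → v ≡ x ⊎ v ≡ x′) → (∀ v → v ∈ Y → v ≡ y ⊎ v ≡ y′) →
                   InducesC₄ G S × n ≤ k + k + k + k
    pair-pair⇒C₄ {x = x} {x′} {y} {y′} B x∈X x′∈X y∈Y y′∈Y x≢x′ y≢y′ X≡ Y≡ =
      induces-C₄ B x∈X x′∈X y∈Y y′∈Y x≢x′ y≢y′ X≡ Y≡ ,
      ≮⇒≥ (λ 4k<n → no-induced-C₄ big 4k<n (complete x y x∈X y∈Y) (complete x y′ x∈X y′∈Y)
                      (complete x′ y x′∈X y∈Y) (complete x′ y′ x′∈X y′∈Y)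
                      (Y-independent y y′ y∈Y y′∈Y) y≢y′ (X-independent x x′ x∈X x′∈X) x≢x′)
      where open Bipartition B

    biclique-shape : ∀ {S} → IsBiclique G S →
                     (InducesP₃ G S × suc (suc (k + k + k)) ≤ n) ⊎ (InducesC₄ G S × n ≤ k + k + k + k)
    biclique-shape biclique with bipartition (proj₁ biclique)
    ... | X , Y , B with Bipartition.X-nonempty B | Bipartition.Y-nonempty B
    ... | x , x∈X | y , y∈Y with part-≤2 B x∈X | part-≤2 (swapParts B) y∈Y
    ... | inj₁ X≡x | inj₁ Y≡y =
      ⊥-elim (single-single⇒⊥ biclique B x∈X y∈Y X≡x Y≡y)
    ... | inj₂ (x′ , x′∈X , x≢x′ , X≡) | inj₁ Y≡y =
      inj₁ (pair-single⇒P₃ biclique B x∈X x′∈X y∈Y x≢x′ X≡ Y≡y)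
    ... | inj₁ X≡x | inj₂ (y′ , y′∈Y , y≢y′ , Y≡) =
      inj₁ (pair-single⇒P₃ biclique (swapParts B) y∈Y y′∈Y x∈X y≢y′ Y≡ X≡x)
    ... | inj₂ (x′ , x′∈X , x≢x′ , X≡) | inj₂ (y′ , y′∈Y , y≢y′ , Y≡) =
      inj₂ (pair-pair⇒C₄ B x∈X x′∈X y∈Y y′∈Y x≢x′ y≢y′ X≡ Y≡)

    pair-saturated : ∀ {x x′ y Y} → x ≢ x′ → G y x → G y x′ → ¬ G x x′ → y ∈ Y → Saturated (pair x x′) Y
    pair-saturated x≢x′ yx yx′ ¬xx′ y∈Y z z-Y z-pair = ∈-pair⁺
      (neighbourhood-independence≤2 big yx yx′ ¬xx′ x≢x′
        (G-sym (z-Y _ y∈Y)) (z-pair _ (a∈pair _ _) ∘ G-sym) (z-pair _ (b∈pair _ _) ∘ G-sym))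

    induced-C₄-biclique : ∀ {x x′ y y′} → x ≢ x′ → y ≢ y′ → G x y → G x y′ → G x′ y → G x′ y′ →
                          ¬ G x x′ → ¬ G y y′ → ∃[ S ] IsBiclique G S × InducesC₄ G S
    induced-C₄-biclique {x} {x′} {y} {y′} x≢x′ y≢y′ xy xy′ x′y x′y′ ¬xx′ ¬yy′ =
      pair x x′ ∪ pair y y′ ,
      saturated⇒biclique B (pair-saturated x≢x′ (G-sym xy) (G-sym x′y) ¬xx′ (a∈pair y y′))
                           (pair-saturated y≢y′ xy xy′ ¬yy′ (a∈pair x x′)) ,
      induces-C₄ B (a∈pair x x′) (b∈pair x x′) (a∈pair y y′) (b∈pair y y′) x≢x′ y≢y′
        (λ _ → ∈-pair⁻) (λ _ → ∈-pair⁻)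
      where
      B = unionBipartition (x , a∈pair x x′) (y , a∈pair y y′) (pair-complete xy xy′ x′y x′y′)
                           (pair-independent ¬xx′) (pair-independent ¬yy′)

    induced-P₃-biclique : ∀ {x x′ y} → x ≢ x′ → G x y → G x′ y → ¬ G x x′ →
                          (∀ z → G x z → G x′ z → ¬ G y z → y ≡ z) → ∃[ S ] IsBiclique G S × InducesP₃ G S
    induced-P₃-biclique {x} {x′} {y} x≢x′ xy x′y ¬xx′ y-only =
      pair x x′ ∪ ⁅ y ⁆ ,
      saturated⇒biclique B (pair-saturated x≢x′ (G-sym xy) (G-sym x′y) ¬xx′ (x∈⁅x⁆ y)) y-saturated ,
      induces-P₃ B (a∈pair x x′) (b∈pair x x′) (x∈⁅x⁆ y) x≢x′ (λ _ → ∈-pair⁻) (λ _ → x∈⁅y⁆⇒x≡y y)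
      where
      B = unionBipartition (x , a∈pair x x′) (y , x∈⁅x⁆ y) (pair-singleton-complete xy x′y)
                           (pair-independent ¬xx′) singleton-independent
      y-saturated : Saturated ⁅ y ⁆ (pair x x′)
      y-saturated z z-pair z-y = subst (_∈ ⁅ y ⁆) (y-only z (G-sym (z-pair x (a∈pair x x′)))
        (G-sym (z-pair x′ (b∈pair x x′))) (z-y y (x∈⁅x⁆ y) ∘ G-sym)) (x∈⁅x⁆ y)

  small-complete : n ≤ suc (k + k) → ∀ {u v} → u ≢ v → G u v
  small-complete small {u} u≢v = Adj-0⇒G u (small-adj small (n≢0⇒n>0 (pos≢0 u u≢v ∘ sym)) (pos<n u _))

  small-P₂ : n ≤ suc (k + k) → ∀ {S} → IsCompleteBipartite G S → InducesP₂ G S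
  small-P₂ small cb with bipartition cb
  ... | X , Y , B = induces-P₂ B x∈X y∈Y (singleton X-independent x∈X) (singleton Y-independent y∈Y)
    where
    open Bipartition B
    x∈X = proj₂ X-nonempty
    y∈Y = proj₂ Y-nonempty
    singleton : ∀ {Z z} → Independent Z → z ∈ Z → ∀ v → v ∈ Z → v ≡ z
    singleton {z = z} Z-ind z∈Z v v∈Z with v ≟ᶠ z
    ... | yes v≡z = v≡z
    ... | no v≢z = ⊥-elim (Z-ind v z v∈Z z∈Z (small-complete small v≢z))

  at : ℕ → Fin n
  at = vertexAt zero

  pos-at : ∀ {u} → u < n → pos zero (at u) ≡ u
  pos-at = pos-vertexAt zero

  G-at : ∀ {u w} → u < n → w < n → Adj u w → G (at u) (at w)
  G-at u<n w<n a = Adj⇒G zero (subst₂ Adj (sym (pos-at u<n)) (sym (pos-at w<n)) a)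

  ¬G-at : ∀ {u w} → u < n → w < n → ¬ Adj u w → ¬ G (at u) (at w)
  ¬G-at u<n w<n ¬a = ¬a ∘ subst₂ Adj (pos-at u<n) (pos-at w<n) ∘ G⇒Adj zero

  at-≢ : ∀ {u w} → u < n → w < n → u ≢ w → at u ≢ at w
  at-≢ u<n w<n u≢w eq = u≢w (trans (sym (pos-at u<n)) (trans (cong (pos zero) eq) (pos-at w<n)))

  3k+2≤n⇒2k+2≤n : suc (suc (k + k + k)) ≤ n → suc (suc (k + k)) ≤ n
  3k+2≤n⇒2k+2≤n = ≤-trans (s≤s (s≤s (m≤m+n (k + k) k)))

  module _ (k≥1 : 1 ≤ k) (lower : suc (suc (k + k + k)) ≤ n) where

    private
      big : suc (suc (k + k)) ≤ n
      big = 3k+2≤n⇒2k+2≤n lower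

    adj-k-0 : Adj k 0
    adj-k-0 = Adj-sym (adj-within k≥1 (k<n big) ≤-refl)

    P₃-biclique-exists : ∃[ S ] IsBiclique G S × InducesP₃ G S
    P₃-biclique-exists = induced-P₃-biclique big (at-≢ (k<n big) m<n (<⇒≢ k<m))
      (G-at (k<n big) 0<n adj-k-0) (G-at m<n 0<n (Adj-sym (adj-around 0<m n≤m+k)))
      (¬G-at (k<n big) m<n ¬adj-k-m) only-0
      where
      m<n : m < n
      m<n = ≤-refl
      0<n : 0 < n
      0<n = z<s
      3k<m : k + k + k < m
      3k<m = s≤s⁻¹ lower
      k<m : k < m
      k<m = ≤-<-trans (≤-trans (m≤m+n k k) (m≤m+n (k + k) k)) 3k<m
      0<m : 0 < m
      0<m = ≤-<-trans z≤n k<m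
      n≤m+k : n ≤ m + k
      n≤m+k = subst (_≤ m + k) (+-comm m 1) (+-monoʳ-≤ m k≥1)
      ¬adj-k-m : ¬ Adj k m
      ¬adj-k-m a with adj-elim k<m m<n a
      ... | inj₁ m≤k+k = <⇒≱ (≤-<-trans (m≤m+n (k + k) k) 3k<m) m≤k+k
      ... | inj₂ k+n≤m+k = <⇒≱ (subst (_< k + n) (+-comm k m) (+-monoʳ-< k m<n)) k+n≤m+k
      only-0 : ∀ z → G (at k) z → G (at m) z → ¬ G (at 0) z → at 0 ≡ z
      only-0 z kz mz ¬0z with at 0 ≟ᶠ z
      ... | yes 0≡z = 0≡z
      ... | no 0≢z = ⊥-elim (<⇒≱ 3k<m (subst₂ (λ a b → b ≤ a + k + k) (pos-at (k<n big)) (pos-at m<n)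
              (common-neighbour-bound big opp kz mz ¬0z 0≢z)))
        where
        opp : Opposite zero (at k) (at m)
        opp = subst Ahead (sym (pos-at (k<n big))) (k≥1 , ≤-refl) ,
              subst Behind (sym (pos-at m<n)) (m<n , n≤m+k)

    C₄-biclique-exists : n ≤ k + k + k + k → ∃[ S ] IsBiclique G S × InducesC₄ G S
    C₄-biclique-exists upper =
      induced-C₄-biclique big (at-≢ (k<n big) r<n (<⇒≢ k<r)) (at-≢ 0<n 2k<n (<⇒≢ 0<2k))
      (G-at (k<n big) 0<n adj-k-0) (G-at (k<n big) 2k<n (adj-within k<2k 2k<n ≤-refl))
      (G-at r<n 0<n (Adj-sym (adj-around 0<r (≤-reflexive (sym r+k≡n)))))
      (G-at r<n 2k<n (Adj-sym (adj-within 2k<r r<n r≤3k)))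
      (¬G-at (k<n big) r<n ¬adj-k-r) (¬G-at 0<n 2k<n ¬adj-0-2k)
      where
      -- The cycle 0, k, 2k, n - k: consecutive positions are within k of each other.
      r = n ∸ k
      r+k≡n : r + k ≡ n
      r+k≡n = m∸n+n≡m (<⇒≤ (k<n big))
      0<n : 0 < n
      0<n = z<s
      3k<n : k + k + k < n
      3k<n = ≤-trans (n≤1+n _) lower
      k<2k : k < k + k
      k<2k = m<m+n k k≥1
      0<2k : 0 < k + k
      0<2k = ≤-<-trans z≤n k<2k
      2k<n : k + k < n
      2k<n = ≤-<-trans (m≤m+n (k + k) k) 3k<n
      2k<r : k + k < r
      2k<r = +-cancelʳ-< k (k + k) r (subst (k + k + k <_) (sym r+k≡n) 3k<n)
      k<r : k < r
      k<r = <-trans k<2k 2k<r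
      0<r : 0 < r
      0<r = ≤-<-trans z≤n k<r
      r<n : r < n
      r<n = subst (r <_) r+k≡n (m<m+n r k≥1)
      r≤3k : r ≤ k + k + k
      r≤3k = +-cancelʳ-≤ k r (k + k + k) (subst (_≤ k + k + k + k) (sym r+k≡n) upper)
      ¬adj-k-r : ¬ Adj k r
      ¬adj-k-r a with adj-elim k<r r<n a
      ... | inj₁ r≤k+k = <⇒≱ 2k<r r≤k+k
      ... | inj₂ k+n≤r+k = <⇒≱ r<n (+-cancelˡ-≤ k n r (subst (k + n ≤_) (+-comm r k) k+n≤r+k))
      ¬adj-0-2k : ¬ Adj 0 (k + k)
      ¬adj-0-2k a with adj-elim 0<2k 2k<n a
      ... | inj₁ 2k≤k = <⇒≱ k<2k 2k≤k
      ... | inj₂ n≤3k = <⇒≱ 3k<n n≤3k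

  P₂-range : n ≤ 2 * k + 1 → ∀ S → IsBiclique G S → InducesP₂ G S
  P₂-range n≤2k+1 S biclique = small-P₂ (subst (n ≤_) (2*k+1≡1+[k+k] k) n≤2k+1) (proj₁ biclique)

  C₄-range : 2 * k + 2 ≤ n → n ≤ 3 * k + 1 → ∀ S → IsBiclique G S → InducesC₄ G S
  C₄-range 2k+2≤n n≤3k+1 S biclique =
    [ (λ (_ , 3k+1<n) → ⊥-elim (<⇒≱ 3k+1<n (subst (n ≤_) (3*k+1≡1+[k+k+k] k) n≤3k+1))) , proj₁ ]′
      (biclique-shape (subst (_≤ n) (2*k+2≡2+[k+k] k) 2k+2≤n) biclique)

  P₃-range : 1 ≤ k → 4 * k + 1 ≤ n → ∀ S → IsBiclique G S → InducesP₃ G S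
  P₃-range k≥1 4k+1≤n S biclique =
    [ proj₁ , (λ (_ , n≤4k) → ⊥-elim (<⇒≱ 4k<n n≤4k)) ]′ (biclique-shape 2k+2≤n biclique)
    where
    4k<n : k + k + k + k < n
    4k<n = subst (_≤ n) (4*k+1≡1+[k+k+k+k] k) 4k+1≤n
    2k+2≤n : suc (suc (k + k)) ≤ n
    2k+2≤n = ≤-trans (s≤s (≤-trans (m<m+n (k + k) k≥1) (m≤m+n (k + k + k) k))) 4k<n

  mixed-range : 1 ≤ k → 3 * k + 2 ≤ n → n ≤ 4 * k →
    (∀ S → IsBiclique G S → InducesP₃ G S ⊎ InducesC₄ G S) ×
    (∃[ S ] IsBiclique G S × InducesP₃ G S) × (∃[ S ] IsBiclique G S × InducesC₄ G S)
  mixed-range k≥1 3k+2≤n n≤4k =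
    (λ S biclique → Sum.map proj₁ proj₁ (biclique-shape (3k+2≤n⇒2k+2≤n lower) biclique)) ,
    P₃-biclique-exists k≥1 lower , C₄-biclique-exists k≥1 lower (subst (n ≤_) (4*k≡k+k+k+k k) n≤4k)
    where lower = subst (_≤ n) (3*k+2≡2+[k+k+k] k) 3k+2≤n

lemma2 : (k n : ℕ) → 1 ≤ k →
    (n ≤ 2 * k + 1 →
       ∀ (S : Subset n) → IsBiclique (CyclePow n k) S → InducesP₂ (CyclePow n k) S) ×
    (2 * k + 2 ≤ n → n ≤ 3 * k + 1 →
       ∀ (S : Subset n) → IsBiclique (CyclePow n k) S → InducesC₄ (CyclePow n k) S) ×
    (3 * k + 2 ≤ n → n ≤ 4 * k →
       (∀ (S : Subset n) → IsBiclique (CyclePow n k) S →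
          InducesP₃ (CyclePow n k) S ⊎ InducesC₄ (CyclePow n k) S) ×
       (∃[ S ] (IsBiclique (CyclePow n k) S × InducesP₃ (CyclePow n k) S)) ×
       (∃[ S ] (IsBiclique (CyclePow n k) S × InducesC₄ (CyclePow n k) S))) ×
    (4 * k + 1 ≤ n →
       ∀ (S : Subset n) → IsBiclique (CyclePow n k) S → InducesP₃ (CyclePow n k) S)
lemma2 k zero _ =
  (λ { _ _ ((_ , _ , _ , _ , _ , _ , (() , _) , _) , _) }) ,
  ⊥-elim ∘ a+suc-b≰0 , ⊥-elim ∘ a+suc-b≰0 , ⊥-elim ∘ a+suc-b≰0
  where
  a+suc-b≰0 : ∀ {a b} → a + suc b ≰ 0
  a+suc-b≰0 {a} {b} h with subst (_≤ 0) (+-suc a b) h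
  ... | ()
lemma2 k (suc m) k≥1 = P₂-range , C₄-range , mixed-range k≥1 , P₃-range k≥1
  where open CyclePower m k
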